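{- For every graph $G$ with no isolated vertices, $\tilde\gamma_{\times 2}(G)\le 2\tilde\gamma_2(G)$.
   Context: $G=(V,E)$ finite simple graph; $N(v)$, $N[v]$ open and closed neighborhoods; for $f:V\to\{\emptyset,\{a\},\{b\}\}$ let $f_\cup(W)=\bigcup_{w\in W}f(w)$ and weight $f(V)=\sum_v|f(v)|$. $\tilde\gamma_2(G)$ is the minimum weight of $f:V\to\{\emptyset,\{a\},\{b\}\}$ with $f_\cup(N(v))=\{a,b\}$ whenever $f(v)=\emptyset$. $\tilde\gamma_{\times 2}(G)$ is the minimum weight of $f:V\to\{\emptyset,\{a\},\{b\}\}$ with $f_\cup(N[v])=\{a,b\}$ for all $v\in V$. -}

module Defs where

open import Data.Nat using (ℕ; zero; suc; _+_; _≤_)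
open import Data.Fin using (Fin) renaming (zero to fzero; suc to fsuc)
open import Data.Product using (Σ; ∃; _×_; _,_)
open import Data.Sum using (_⊎_)
open import Data.Empty using (⊥)
open import Relation.Nullary using (¬_)
open import Relation.Binary.PropositionalEquality using (_≡_; _≢_)

record Graph (n : ℕ) : Set₁ where
  field
    Adj   : Fin n → Fin n → Set
    sym   : ∀ {u v} → Adj u v → Adj v u
    irrefl : ∀ {v} → ¬ Adj v v

open Graph public

NoIsolated : ∀ {n} → Graph n → Set
NoIsolated {n} G = ∀ (v : Fin n) → ∃ λ (u : Fin n) → Adj G v u

data Label : Set where
  ∅ⁱ  : Label
  ｛a｝ : Label
  ｛b｝ : Label

card : Label → ℕ
card ∅ⁱ  = 0
card ｛a｝ = 1
card ｛b｝ = 1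

sumFin : ∀ n → (Fin n → ℕ) → ℕ
sumFin zero    g = 0
sumFin (suc n) g = g fzero + sumFin n (λ i → g (fsuc i))


weight : ∀ {n} → (Fin n → Label) → ℕ
weight {n} f = sumFin n (λ v → card (f v))

OpenNbhdFull : ∀ {n} → Graph n → (Fin n → Label) → Fin n → Set
OpenNbhdFull G f v =
  (∃ λ u → Adj G v u × f u ≡ ｛a｝) × (∃ λ u → Adj G v u × f u ≡ ｛b｝)

InClosed : ∀ {n} → Graph n → Fin n → Fin n → Set
InClosed G v u = (u ≡ v) ⊎ Adj G v u

ClosedNbhdFull : ∀ {n} → Graph n → (Fin n → Label) → Fin n → Set
ClosedNbhdFull G f v =
  (∃ λ u → InClosed G v u × f u ≡ ｛a｝) × (∃ λ u → InClosed G v u × f u ≡ ｛b｝)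

Is2RainbowLike : ∀ {n} → Graph n → (Fin n → Label) → Set
Is2RainbowLike {n} G f = ∀ (v : Fin n) → f v ≡ ∅ⁱ → OpenNbhdFull G f v

IsDoubleLike : ∀ {n} → Graph n → (Fin n → Label) → Set
IsDoubleLike {n} G f = ∀ (v : Fin n) → ClosedNbhdFull G f v

IsMinWeight : ∀ {n} → ((Fin n → Label) → Set) → ℕ → Set
IsMinWeight {n} P k =
  (Σ (Fin n → Label) λ f → P f × weight f ≡ k)
  × (∀ (f : Fin n → Label) → P f → k ≤ weight f)

IsGamma2 : ∀ {n} → Graph n → ℕ → Set
IsGamma2 G k = IsMinWeight (Is2RainbowLike G) k

IsGammaX2 : ∀ {n} → Graph n → ℕ → Set
IsGammaX2 G k = IsMinWeight (IsDoubleLike G) k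

-- Start from a γ̃₂-function f.  Call a vertex x *good* for h if h(x) = ∅
-- or some neighbour of x carries the label opposite to h(x).  If every
-- vertex is good, a feasible h for γ̃₂ is already feasible for γ̃×2.  A bad
-- vertex v (labelled ℓ, no neighbour labelled opp ℓ) is repaired at a
-- cost of at most one unit of weight: if v has an empty neighbour u, give u
-- the label opp ℓ; otherwise all neighbours of v carry ℓ and we flip v to
-- opp ℓ (v has a neighbour since G has no isolated vertices).  Each repair
-- keeps γ̃₂-feasibility, keeps good vertices good and makes v good, so by
-- induction on the number of bad vertices we reach a γ̃×2-function of
-- weight ≤ w(f) + #bad(f) ≤ 2 w(f), as only labelled vertices can be bad.
module Submission where

open import Defs hiding (sym; irrefl)
open import Data.Nat using (ℕ; zero; suc; _+_; _*_; _≤_; _<_; z≤n; s≤s; _≤?_)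
open import Data.Nat.Properties
  using (≤-refl; ≤-trans; ≤-reflexive; m≤m+n; +-mono-≤; +-mono-<-≤; +-mono-≤-<; +-monoʳ-≤; +-suc; +-identityʳ; module ≤-Reasoning)
open import Data.Nat.Induction using (<-wellFounded)
open import Data.Fin using (Fin) renaming (zero to fzero; suc to fsuc)
open import Data.Fin.Properties using (any?; all?; ¬∀⟶∃¬; suc-injective) renaming (_≟_ to _≟F_)
open import Data.Vec.Functional using (updateAt)
open import Data.Vec.Functional.Properties using (updateAt-updates; updateAt-minimal)
open import Data.Product using (Σ; ∃; _×_; _,_; proj₁; proj₂)
open import Data.Sum using (_⊎_; inj₁; inj₂)
open import Data.Empty using (⊥-elim)
open import Function using (const)
open import Induction.WellFounded using (Acc; acc)
open import Relation.Nullary using (¬_; Dec; yes; no)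
open import Relation.Nullary.Decidable using (_×-dec_; _⊎-dec_; decidable-stable; ¬¬-excluded-middle)
open import Relation.Nullary.Negation using (¬¬-map)
open import Relation.Binary.PropositionalEquality using (_≡_; _≢_; refl; sym; trans; cong; module ≡-Reasoning)

opp : Label → Label
opp ∅ⁱ  = ∅ⁱ
opp ｛a｝ = ｛b｝
opp ｛b｝ = ｛a｝

opp-involutive : ∀ ℓ → opp (opp ℓ) ≡ ℓ
opp-involutive ∅ⁱ  = refl
opp-involutive ｛a｝ = refl
opp-involutive ｛b｝ = refl

opp-nonempty : ∀ {ℓ} → ℓ ≢ ∅ⁱ → opp ℓ ≢ ∅ⁱ
opp-nonempty {∅ⁱ} ℓ≢∅ = ℓ≢∅
opp-nonempty {｛a｝} _ ()
opp-nonempty {｛b｝} _ ()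

opp-distinct : ∀ {ℓ} → ℓ ≢ ∅ⁱ → ℓ ≢ opp ℓ
opp-distinct {∅ⁱ} ℓ≢∅ = ⊥-elim (ℓ≢∅ refl)
opp-distinct {｛a｝} _ ()
opp-distinct {｛b｝} _ ()

remaining-label : ∀ {ℓ w} → ℓ ≢ ∅ⁱ → w ≢ ∅ⁱ → w ≢ opp ℓ → w ≡ ℓ
remaining-label {∅ⁱ}          ℓ≢∅ _   _   = ⊥-elim (ℓ≢∅ refl)
remaining-label {_}   {∅ⁱ}    _   w≢∅ _   = ⊥-elim (w≢∅ refl)
remaining-label {｛a｝} {｛a｝} _   _   _   = refl
remaining-label {｛a｝} {｛b｝} _   _   w≢b = ⊥-elim (w≢b refl)
remaining-label {｛b｝} {｛a｝} _   _   w≢a = ⊥-elim (w≢a refl)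
remaining-label {｛b｝} {｛b｝} _   _   _   = refl

_≟L_ : (x y : Label) → Dec (x ≡ y)
∅ⁱ  ≟L ∅ⁱ  = yes refl
∅ⁱ  ≟L ｛a｝ = no λ ()
∅ⁱ  ≟L ｛b｝ = no λ ()
｛a｝ ≟L ∅ⁱ  = no λ ()
｛a｝ ≟L ｛a｝ = yes refl
｛a｝ ≟L ｛b｝ = no λ ()
｛b｝ ≟L ∅ⁱ  = no λ ()
｛b｝ ≟L ｛a｝ = no λ ()
｛b｝ ≟L ｛b｝ = yes refl

card≤1 : ∀ ℓ → card ℓ ≤ 1
card≤1 ∅ⁱ  = z≤n
card≤1 ｛a｝ = s≤s z≤n
card≤1 ｛b｝ = s≤s z≤n

sum-mono : ∀ n {f g : Fin n → ℕ} → (∀ i → f i ≤ g i) → sumFin n f ≤ sumFin n g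
sum-mono zero    f≤g = z≤n
sum-mono (suc n) f≤g = +-mono-≤ (f≤g fzero) (sum-mono n (λ i → f≤g (fsuc i)))

sum-strict : ∀ n {f g : Fin n → ℕ} → (∀ i → f i ≤ g i) →
             (v : Fin n) → f v < g v → sumFin n f < sumFin n g
sum-strict (suc n) f≤g fzero    fv<gv = +-mono-<-≤ fv<gv (sum-mono n (λ i → f≤g (fsuc i)))
sum-strict (suc n) f≤g (fsuc v) fv<gv =
  +-mono-≤-< (f≤g fzero) (sum-strict n (λ i → f≤g (fsuc i)) v fv<gv)

sum-≤-except : ∀ n {f g : Fin n → ℕ} (u : Fin n) → (∀ i → i ≢ u → f i ≤ g i) →
               f u ≤ suc (g u) → sumFin n f ≤ suc (sumFin n g)
sum-≤-except (suc n) fzero f≤g fu≤ = +-mono-≤ fu≤ (sum-mono n (λ i → f≤g (fsuc i) λ ()))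
sum-≤-except (suc n) {g = g} (fsuc u) f≤g fu≤ = ≤-trans
  (+-mono-≤ (f≤g fzero λ ()) (sum-≤-except n u (λ i i≢u → f≤g (fsuc i) (λ e → i≢u (suc-injective e))) fu≤))
  (≤-reflexive (+-suc (g fzero) _))

_[_≔_] : ∀ {n} → (Fin n → Label) → Fin n → Label → Fin n → Label
h [ u ≔ ℓ ] = updateAt h u (const ℓ)

≔-updates : ∀ {n} (h : Fin n → Label) u ℓ → (h [ u ≔ ℓ ]) u ≡ ℓ
≔-updates h u ℓ = updateAt-updates u h

≔-elsewhere : ∀ {n} (h : Fin n → Label) {u} ℓ {x} → x ≢ u → (h [ u ≔ ℓ ]) x ≡ h x
≔-elsewhere h {u} ℓ {x} = updateAt-minimal x u h

weight-≔ : ∀ {n} (h : Fin n → Label) u ℓ → weight (h [ u ≔ ℓ ]) ≤ suc (weight h)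
weight-≔ {n} h u ℓ = sum-≤-except n u
  (λ i i≢u → ≤-reflexive (cong card (≔-elsewhere h ℓ i≢u)))
  (≤-trans (card≤1 ((h [ u ≔ ℓ ]) u)) (s≤s z≤n))

defect : ∀ {P : Set} → Dec P → ℕ
defect (yes _) = 0
defect (no _)  = 1

defect≤1 : ∀ {P : Set} (d : Dec P) → defect d ≤ 1
defect≤1 (yes _) = z≤n
defect≤1 (no _)  = s≤s z≤n

defect-yes : ∀ {P : Set} (d : Dec P) → P → defect d ≡ 0
defect-yes (yes _) _ = refl
defect-yes (no ¬p) p = ⊥-elim (¬p p)

defect-mono : ∀ {P Q : Set} → (P → Q) → (d : Dec P) (e : Dec Q) → defect e ≤ defect d
defect-mono _   _       (yes _)  = z≤n
defect-mono P⇒Q (yes p) (no ¬q) = ⊥-elim (¬q (P⇒Q p))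
defect-mono _   (no _)  (no _)  = s≤s z≤n

defect-strict : ∀ {P Q : Set} (d : Dec P) (e : Dec Q) → ¬ P → Q → defect e < defect d
defect-strict (yes p) _       ¬p _ = ⊥-elim (¬p p)
defect-strict (no _)  (yes _) _  _ = s≤s z≤n
defect-strict (no _)  (no ¬q) _  q = ⊥-elim (¬q q)

defect≤card : ∀ {P : Set} (d : Dec P) ℓ → (ℓ ≡ ∅ⁱ → P) → defect d ≤ card ℓ
defect≤card d ∅ⁱ  p = ≤-reflexive (defect-yes d (p refl))
defect≤card d ｛a｝ _ = defect≤1 d
defect≤card d ｛b｝ _ = defect≤1 d

-- The repair procedure; deciding adjacency lets us count and find bad vertices.
module Repair {n : ℕ} (G : Graph n) (adj? : ∀ u v → Dec (Adj G u v)) where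

  Labelling : Set
  Labelling = Fin n → Label

  Feasible : Labelling → Set
  Feasible = Is2RainbowLike G

  adj-sym : ∀ {u v} → Adj G u v → Adj G v u
  adj-sym = Graph.sym G

  SeesLabel : Labelling → Label → Fin n → Set
  SeesLabel h ℓ x = ∃ λ u → Adj G x u × h u ≡ ℓ

  seesLabel? : ∀ h ℓ x → Dec (SeesLabel h ℓ x)
  seesLabel? h ℓ x = any? (λ u → adj? x u ×-dec (h u ≟L ℓ))

  Good : Labelling → Fin n → Set
  Good h x = h x ≡ ∅ⁱ ⊎ SeesLabel h (opp (h x)) x

  good? : ∀ h x → Dec (Good h x)
  good? h x = (h x ≟L ∅ⁱ) ⊎-dec seesLabel? h (opp (h x)) x

  badCount : Labelling → ℕ
  badCount h = sumFin n (λ x → defect (good? h x))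

  -- Only labelled vertices can be bad.
  badCount≤weight : ∀ h → badCount h ≤ weight h
  badCount≤weight h = sum-mono n (λ x → defect≤card (good? h x) (h x) inj₁)

  badCount-decreases : ∀ h h' v → (∀ x → Good h x → Good h' x) → ¬ Good h v → Good h' v →
                       badCount h' < badCount h
  badCount-decreases h h' v preserve bad good = sum-strict n
    (λ x → defect-mono (preserve x) (good? h x) (good? h' x)) v
    (defect-strict (good? h v) (good? h' v) bad good)

  feasible-preserved : ∀ {h h'} → Feasible h → (∀ x → h' x ≡ ∅ⁱ → h x ≡ ∅ⁱ) →
    (∀ x w → h x ≡ ∅ⁱ → Adj G x w → h w ≢ ∅ⁱ → h' w ≡ h w) → Feasible h'
  feasible-preserved {h} {h'} feasible newEmpty keep x h'x≡∅ =
    transfer (proj₁ (feasible x hx≡∅)) (λ ()) , transfer (proj₂ (feasible x hx≡∅)) (λ ())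
    where
    hx≡∅ = newEmpty x h'x≡∅
    transfer : ∀ {ℓ} → SeesLabel h ℓ x → ℓ ≢ ∅ⁱ → SeesLabel h' ℓ x
    transfer (w , x~w , hw≡ℓ) ℓ≢∅ =
      w , x~w , trans (keep x w hx≡∅ x~w (λ hw≡∅ → ℓ≢∅ (trans (sym hw≡ℓ) hw≡∅))) hw≡ℓ

  good-preserved : ∀ {h h' x} → h' x ≡ h x →
    (∀ w → Adj G x w → h x ≢ ∅ⁱ → h w ≡ opp (h x) → h' w ≡ h w) → Good h x → Good h' x
  good-preserved h'x≡hx _ (inj₁ hx≡∅) = inj₁ (trans h'x≡hx hx≡∅)
  good-preserved {h} {h'} {x} h'x≡hx keep (inj₂ (w , x~w , hw≡opp)) with h x ≟L ∅ⁱ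
  ... | yes hx≡∅ = inj₁ (trans h'x≡hx hx≡∅)
  ... | no hx≢∅  = inj₂ (w , x~w , trans (keep w x~w hx≢∅ hw≡opp)
                                        (trans hw≡opp (cong opp (sym h'x≡hx))))

  record Improvement (h : Labelling) : Set where
    field
      next       : Labelling
      feasible   : Feasible next
      fewerBad   : badCount next < badCount h
      weightStep : weight next ≤ suc (weight h)

  fillEmptyNeighbour : ∀ h → Feasible h → ∀ v → ¬ Good h v → ∀ u → Adj G v u → h u ≡ ∅ⁱ →
                       Improvement h
  fillEmptyNeighbour h feasible v bad u v~u hu≡∅ = record
    { next       = h'
    ; feasible   = feasible-preserved feasible newEmpty
                     (λ x w _ _ hw≢∅ → ≔-elsewhere h ℓ' (labelled≢u hw≢∅))
    ; fewerBad   = badCount-decreases h h' v preserve bad vGood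
    ; weightStep = weight-≔ h u ℓ'
    }
    where
    ℓ' = opp (h v)
    h' = h [ u ≔ ℓ' ]
    hv≢∅ : h v ≢ ∅ⁱ
    hv≢∅ hv≡∅ = bad (inj₁ hv≡∅)
    labelled≢u : ∀ {x} → h x ≢ ∅ⁱ → x ≢ u
    labelled≢u hx≢∅ refl = hx≢∅ hu≡∅
    newEmpty : ∀ x → h' x ≡ ∅ⁱ → h x ≡ ∅ⁱ
    newEmpty x h'x≡∅ with x ≟F u
    ... | yes refl = ⊥-elim (opp-nonempty hv≢∅ (trans (sym (≔-updates h u ℓ')) h'x≡∅))
    ... | no x≢u   = trans (sym (≔-elsewhere h ℓ' x≢u)) h'x≡∅
    uGood : Good h' u
    uGood = inj₂ (v , adj-sym v~u , (begin
      h' v              ≡⟨ ≔-elsewhere h ℓ' (labelled≢u hv≢∅) ⟩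
      h v               ≡⟨ sym (opp-involutive (h v)) ⟩
      opp ℓ'            ≡⟨ cong opp (sym (≔-updates h u ℓ')) ⟩
      opp (h' u)        ∎))
      where open ≡-Reasoning
    oppLabelled : ∀ {x w} → h x ≢ ∅ⁱ → h w ≡ opp (h x) → h w ≢ ∅ⁱ
    oppLabelled hx≢∅ hw≡opp hw≡∅ = opp-nonempty hx≢∅ (trans (sym hw≡opp) hw≡∅)
    preserve : ∀ x → Good h x → Good h' x
    preserve x xGood with x ≟F u
    ... | yes refl = uGood
    ... | no x≢u   = good-preserved (≔-elsewhere h ℓ' x≢u)
      (λ w _ hx≢∅ hw≡opp → ≔-elsewhere h ℓ' (labelled≢u (oppLabelled hx≢∅ hw≡opp))) xGood
    vGood : Good h' v
    vGood = inj₂ (u , v~u , trans (≔-updates h u ℓ') (cong opp (sym (≔-elsewhere h ℓ' (labelled≢u hv≢∅)))))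

  -- Case 2: every neighbour of the bad vertex v is labelled, hence labelled
  -- like v; flip v to the opposite label.  Its neighbour p now sees it.
  flipVertex : NoIsolated G → ∀ h → Feasible h → ∀ v → ¬ Good h v →
               ¬ SeesLabel h ∅ⁱ v → Improvement h
  flipVertex noIsolated h feasible v bad noEmptyNeighbour = record
    { next       = h'
    ; feasible   = feasible-preserved feasible newEmpty
                     (λ x w hx≡∅ x~w _ → ≔-elsewhere h ℓ' (emptyNeighbour≢v hx≡∅ x~w))
    ; fewerBad   = badCount-decreases h h' v preserve bad vGood
    ; weightStep = weight-≔ h v ℓ'
    }
    where
    ℓ' = opp (h v)
    h' = h [ v ≔ ℓ' ]
    hv≢∅ : h v ≢ ∅ⁱ
    hv≢∅ hv≡∅ = bad (inj₁ hv≡∅)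
    neighbour-label : ∀ w → Adj G v w → h w ≡ h v
    neighbour-label w v~w = remaining-label hv≢∅
      (λ hw≡∅ → noEmptyNeighbour (w , v~w , hw≡∅)) (λ hw≡ℓ' → bad (inj₂ (w , v~w , hw≡ℓ')))
    emptyNeighbour≢v : ∀ {x w} → h x ≡ ∅ⁱ → Adj G x w → w ≢ v
    emptyNeighbour≢v hx≡∅ x~v refl = noEmptyNeighbour (_ , adj-sym x~v , hx≡∅)
    newEmpty : ∀ x → h' x ≡ ∅ⁱ → h x ≡ ∅ⁱ
    newEmpty x h'x≡∅ with x ≟F v
    ... | yes refl = ⊥-elim (opp-nonempty hv≢∅ (trans (sym (≔-updates h v ℓ')) h'x≡∅))
    ... | no x≢v   = trans (sym (≔-elsewhere h ℓ' x≢v)) h'x≡∅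
    -- A neighbour of a good x carrying opp (h x) cannot be v, which shares
    -- its label with all its neighbours.
    oppNeighbour≢v : ∀ {x w} → Adj G x w → h w ≡ opp (h x) → w ≢ v
    oppNeighbour≢v {x} x~v hv≡opp refl =
      opp-distinct hv≢∅ (trans hv≡opp (cong opp (neighbour-label x (adj-sym x~v))))
    preserve : ∀ x → Good h x → Good h' x
    preserve x xGood with x ≟F v
    ... | yes refl = ⊥-elim (bad xGood)
    ... | no x≢v   = good-preserved (≔-elsewhere h ℓ' x≢v)
      (λ w x~w _ hw≡opp → ≔-elsewhere h ℓ' (oppNeighbour≢v x~w hw≡opp)) xGood
    vGood : Good h' v
    vGood with noIsolated v
    ... | p , v~p = inj₂ (p , v~p , (begin
      h' p             ≡⟨ ≔-elsewhere h ℓ' p≢v ⟩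
      h p              ≡⟨ neighbour-label p v~p ⟩
      h v              ≡⟨ sym (opp-involutive (h v)) ⟩
      opp ℓ'           ≡⟨ cong opp (sym (≔-updates h v ℓ')) ⟩
      opp (h' v)       ∎))
      where
      open ≡-Reasoning
      p≢v : p ≢ v
      p≢v refl = Graph.irrefl G v~p

  improve : NoIsolated G → ∀ h → Feasible h → ∀ v → ¬ Good h v → Improvement h
  improve noIsolated h feasible v bad with seesLabel? h ∅ⁱ v
  ... | yes (u , v~u , hu≡∅) = fillEmptyNeighbour h feasible v bad u v~u hu≡∅
  ... | no noEmptyNeighbour  = flipVertex noIsolated h feasible v bad noEmptyNeighbour

  allGood⇒double : ∀ h → Feasible h → (∀ x → Good h x) → IsDoubleLike G h
  allGood⇒double h feasible allGood x with h x ≟L ∅ⁱ | allGood x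
  ... | yes hx≡∅ | _ with feasible x hx≡∅
  ...   | (wa , x~wa , a) , (wb , x~wb , b) = (wa , inj₂ x~wa , a) , (wb , inj₂ x~wb , b)
  allGood⇒double h feasible allGood x | no hx≢∅ | inj₁ hx≡∅ = ⊥-elim (hx≢∅ hx≡∅)
  allGood⇒double h feasible allGood x | no hx≢∅ | inj₂ sees = closed (h x) refl hx≢∅ sees
    where
    closed : ∀ ℓ → h x ≡ ℓ → ℓ ≢ ∅ⁱ → SeesLabel h (opp ℓ) x → ClosedNbhdFull G h x
    closed ∅ⁱ  _    ℓ≢∅ _ = ⊥-elim (ℓ≢∅ refl)
    closed ｛a｝ hx≡a _ (w , x~w , hw≡b) = (x , inj₁ refl , hx≡a) , (w , inj₂ x~w , hw≡b)
    closed ｛b｝ hx≡b _ (w , x~w , hw≡a) = (w , inj₂ x~w , hw≡a) , (x , inj₁ refl , hx≡b)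

  DoubleWithin : ℕ → Set
  DoubleWithin bound = Σ Labelling λ g → IsDoubleLike G g × weight g ≤ bound

  repair : NoIsolated G → ∀ h → Feasible h → Acc _<_ (badCount h) →
           DoubleWithin (weight h + badCount h)
  repair noIsolated h feasible (acc smaller) with all? (good? h)
  ... | yes allGood = h , allGood⇒double h feasible allGood , m≤m+n (weight h) (badCount h)
  ... | no notAllGood with ¬∀⟶∃¬ n (Good h) (good? h) notAllGood
  ...   | v , bad with improve noIsolated h feasible v bad
  ...     | record { next = h' ; feasible = feasible' ; fewerBad = fewer ; weightStep = step }
          with repair noIsolated h' feasible' (smaller fewer)
  ...       | g , double , g≤ = g , double , (begin
    weight g                         ≤⟨ g≤ ⟩
    weight h' + badCount h'          ≤⟨ +-mono-≤ step ≤-refl ⟩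
    suc (weight h) + badCount h'     ≡⟨ sym (+-suc (weight h) (badCount h')) ⟩
    weight h + suc (badCount h')     ≤⟨ +-monoʳ-≤ (weight h) fewer ⟩
    weight h + badCount h            ∎)
    where open ≤-Reasoning

  double-of-feasible : NoIsolated G → ∀ f → Feasible f → DoubleWithin (2 * weight f)
  double-of-feasible noIsolated f feasible
    with repair noIsolated f feasible (<-wellFounded (badCount f))
  ... | g , double , g≤ = g , double , (begin
    weight g                ≤⟨ g≤ ⟩
    weight f + badCount f   ≤⟨ +-monoʳ-≤ (weight f) (badCount≤weight f) ⟩
    weight f + weight f     ≡⟨ cong (weight f +_) (sym (+-identityʳ (weight f))) ⟩
    2 * weight f            ∎)
    where open ≤-Reasoning

¬¬-∀Fin : ∀ n {P : Fin n → Set} → (∀ i → ¬ ¬ P i) → ¬ ¬ (∀ i → P i)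
¬¬-∀Fin zero    _     ¬∀ = ¬∀ λ ()
¬¬-∀Fin (suc n) ¬¬P ¬∀ = ¬¬P fzero λ P0 → ¬¬-∀Fin n (λ i → ¬¬P (fsuc i))
  λ Psuc → ¬∀ λ { fzero → P0 ; (fsuc i) → Psuc i }

¬¬-decidable-adjacency : ∀ {n} (G : Graph n) → ¬ ¬ (∀ u v → Dec (Adj G u v))
¬¬-decidable-adjacency {n} G =
  ¬¬-∀Fin n (λ u → ¬¬-∀Fin n (λ v → ¬¬-excluded-middle))

-- Since k ≤ 2m is decidable, we may assume decidable adjacency, and then
-- the repaired double of a γ̃₂-function of weight m bounds k.
mainTheorem18 : ∀ (n : ℕ) (G : Graph n) → NoIsolated G →
    ∀ (k m : ℕ) → IsGammaX2 G k → IsGamma2 G m → k ≤ 2 * m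
mainTheorem18 n G noIsolated k m (_ , kMinimal) ((f , fFeasible , wf≡m) , _) =
  decidable-stable (k ≤? 2 * m) (¬¬-map bound (¬¬-decidable-adjacency G))
  where
  bound : (∀ u v → Dec (Adj G u v)) → k ≤ 2 * m
  bound adj? with Repair.double-of-feasible G adj? noIsolated f fFeasible
  ... | g , gDouble , g≤ = begin
    k             ≤⟨ kMinimal g gDouble ⟩
    weight g      ≤⟨ g≤ ⟩
    2 * weight f  ≡⟨ cong (2 *_) wf≡m ⟩
    2 * m         ∎
    where open ≤-Reasoning
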